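{- Let $0\le k\le n$ and let $D$ be a Le-diagram of type $(k,n)$. Then $D\in\overline{\mathcal{L}_{n,k,1}}$ if and only if there do not exist a circuit $\sigma\in\mathcal{C}(D)$ and $a<b<c$ in $[n]$ such that (i) $\sigma_a,\sigma_c\ne0$; (ii) $\sigma_b=0$; and (iii) $b$ is neither a loop nor a coloop of $D$.
   Context: A Le-diagram $D$ of type $(k,n)$ is a Young diagram contained in a $k\times(n-k)$ rectangle (English notation) whose boxes are filled with $0$'s and $+$'s so that no $0$ has a $+$ above it in the same column and a $+$ to its left in the same row. $S_D\subseteq\mathrm{Gr}_{k,n}^{\ge0}$ is the positroid cell of the totally nonnegative Grassmannian indexed by $D$ under Postnikov's bijection. $\mathcal{V}(D):=\{\mathrm{sign}(v): v\in V^\perp\}\subseteq\{0,+,-\}^n$ for any $V\in S_D$ (independent of the choice of $V$). Partial order on $\{0,+,-\}^n$: $\sigma\le\tau$ iff $\sigma_i=\tau_i$ for all $i$ with $\sigma_i\ne0$. The circuits $\mathcal{C}(D)$ are the minimal elements of $\mathcal{V}(D)\setminus\{0\}$. $i\in[n]$ is a loop of $D$ if $\mathrm{sign}(e^{(i)})\in\mathcal{V}(D)$ ($e^{(i)}$ the $i$th unit vector), and a coloop if $\sigma_i=0$ for all $\sigma\in\mathcal{V}(D)$. $\overline{\mathcal{L}_{n,k,1}}$ is the set of Le-diagrams of type $(k,n)$ with at most one $+$ in each row satisfying the L-condition: there is no $0$ having a $+$ above it in its column and a $+$ to its right in its row. -}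

module Defs where

open import Data.Bool using (Bool; true; false; if_then_else_; _∧_; _∨_; not)
open import Data.Nat as ℕ using (ℕ; zero; suc; _∸_; _≡ᵇ_; _<ᵇ_)
open import Data.Fin using (Fin; toℕ)
open import Data.Product using (Σ; _×_; ∃; ∃-syntax; _,_)
open import Relation.Binary.PropositionalEquality using (_≡_; _≢_)
open import Relation.Nullary using (¬_)
open import Data.Integer as ℤ using (+_)
open import Data.Rational as ℚ using (ℚ; 0ℚ; 1ℚ; _≤ᵇ_; _/_)

-- Le-diagrams of type (k,n)
-- Rows are indexed by Fin k (row 0 = top row), columns by ℕ (column 0 =
-- leftmost).  The
-- filling  fill r c = true  means a  +  in box (r,c), false means a 0;
-- the value of fill outside the diagram is irrelevant (always guarded).

record LeDiagram (k n : ℕ) : Set where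
  field
    shape       : Fin k → ℕ
    shape-bound : ∀ r → shape r ℕ.≤ n ∸ k
    shape-mono  : ∀ r s → toℕ r ℕ.≤ toℕ s → shape s ℕ.≤ shape r
    fill        : Fin k → ℕ → Bool
    le-cond     : ∀ r c → c ℕ.< shape r → fill r c ≡ false →
                  ¬ (Σ (Fin k) λ r' → Σ ℕ λ c' →
                       (toℕ r' ℕ.< toℕ r) × (fill r' c ≡ true) ×
                       (c' ℕ.< c) × (fill r c' ≡ true))

open LeDiagram public

module _ {k n : ℕ} (D : LeDiagram k n) where

  isPlus : Fin k → ℕ → Bool
  isPlus r c = (c <ᵇ shape D r) ∧ fill D r c

  AtMostOnePlusPerRow : Set
  AtMostOnePlusPerRow = ∀ r c c' → isPlus r c ≡ true → isPlus r c' ≡ true → c ≡ c'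

  LCondition : Set
  LCondition = ∀ r c → c ℕ.< shape D r → fill D r c ≡ false →
               ¬ (Σ (Fin k) λ r' → Σ ℕ λ c' →
                    (toℕ r' ℕ.< toℕ r) × (fill D r' c ≡ true) ×
                    (c ℕ.< c') × (isPlus r c' ≡ true))

  InLbar : Set
  InLbar = AtMostOnePlusPerRow × LCondition

sumFin : ∀ {m} → (Fin m → ℚ) → ℚ
sumFin {zero}  f = 0ℚ
sumFin {suc m} f = f Fin.zero ℚ.+ sumFin {m} (λ i → f (Fin.suc i))
  where import Data.Fin as Fin

sumFinℕ : ∀ {m} → (Fin m → ℕ) → ℕ
sumFinℕ {zero}  f = 0
sumFinℕ {suc m} f = f Fin.zero ℕ.+ sumFinℕ {m} (λ i → f (Fin.suc i))
  where import Data.Fin as Fin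

countFin : ∀ {m} → (Fin m → Bool) → ℕ
countFin f = sumFinℕ (λ i → if f i then 1 else 0)

-- A point of the positroid cell S_D: Postnikov's Le-network of D with all
-- edge weights equal to 1, and its (signed) boundary measurement matrix.

module _ {k n : ℕ} (D : LeDiagram k n) where

  -- Boundary path of the Young diagram from the NE to the SW corner of the
  -- k × (n-k) rectangle, steps labelled 1..n; we use 0-based labels.
  -- Vertical step of row r (the source of row r):
  rowLabel : Fin k → ℕ
  rowLabel r = ((n ∸ k) ∸ shape D r) ℕ.+ toℕ r

  colLen : ℕ → ℕ
  colLen c = countFin (λ r → c <ᵇ shape D r)

  -- Horizontal step of column c (the sink of column c), c < n-k:
  colLabel : ℕ → ℕ
  colLabel c = ((n ∸ k) ∸ suc c) ℕ.+ colLen c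

  -- Number of directed paths in the Le-graph from the source of row r0 to
  -- the sink of column t.  Paths travel west along rows and south along
  -- columns, turning only at + boxes (west→south and south→west).
  -- westPaths t b r : number of paths which are travelling west in row r
  --   and may still turn only at + boxes of row r in columns < b.
  westPaths : ℕ → ℕ → Fin k → ℕ
  westPaths t zero    r = 0
  westPaths t (suc b) r =
    westPaths t b r ℕ.+
    (if isPlus D r b
       then (if b ≡ᵇ t then 1 else 0) ℕ.+
            sumFinℕ (λ r' → if (toℕ r <ᵇ toℕ r') ∧ isPlus D r' b
                              then westPaths t b r' else 0)
       else 0)

  numPaths : Fin k → ℕ → ℕ
  numPaths r t = westPaths t (n ∸ k) r

  strictlyBetween : ℕ → ℕ → ℕ → Bool
  strictlyBetween a x b = ((a <ᵇ x) ∧ (x <ᵇ b)) ∨ ((b <ᵇ x) ∧ (x <ᵇ a))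

  sgnExp : ℕ → ℕ → ℕ
  sgnExp i j = countFin (λ r' → strictlyBetween i (rowLabel r') j)

  altSign : ℕ → ℚ
  altSign zero    = 1ℚ
  altSign (suc s) = ℚ.- altSign s

  ℕtoℚ : ℕ → ℚ
  ℕtoℚ m = (+ m) / 1

  -- the k × n matrix whose row space V lies in S_D:
  -- A_{r,j} = δ_{j, rowLabel r} + (-1)^{s} · #paths(r → sink j)
  matrixA : Fin k → Fin n → ℚ
  matrixA r j =
    (if toℕ j ≡ᵇ rowLabel r then 1ℚ else 0ℚ) ℚ.+
    sumFin {n ∸ k} (λ c →
      if toℕ j ≡ᵇ colLabel (toℕ c)
        then altSign (sgnExp (rowLabel r) (toℕ j)) ℚ.* ℕtoℚ (numPaths r (toℕ c))
        else 0ℚ)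

data Sign : Set where
  0ˢ +ˢ -ˢ : Sign

sign : ℚ → Sign
sign q = if q ≤ᵇ 0ℚ then (if 0ℚ ≤ᵇ q then 0ˢ else -ˢ) else +ˢ

SignVec : ℕ → Set
SignVec n = Fin n → Sign

_≤ˢ_ : ∀ {n} → SignVec n → SignVec n → Set
σ ≤ˢ τ = ∀ i → σ i ≢ 0ˢ → σ i ≡ τ i

NonZero : ∀ {n} → SignVec n → Set
NonZero σ = ∃[ i ] σ i ≢ 0ˢ

module _ {k n : ℕ} (D : LeDiagram k n) where

  InVperp : (Fin n → ℚ) → Set
  InVperp v = ∀ r → sumFin (λ j → matrixA D r j ℚ.* v j) ≡ 0ℚ

  InV : SignVec n → Set
  InV σ = ∃[ v ] InVperp v × (∀ j → sign (v j) ≡ σ j)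

  Circuit : SignVec n → Set
  Circuit σ = InV σ × NonZero σ ×
              (∀ τ → InV τ → NonZero τ → τ ≤ˢ σ → ∀ i → τ i ≡ σ i)

  unitSign : Fin n → SignVec n
  unitSign i j = if toℕ i ≡ᵇ toℕ j then +ˢ else 0ˢ

  Loop : Fin n → Set
  Loop i = InV (unitSign i)

  Coloop : Fin n → Set
  Coloop i = ∀ σ → InV σ → σ i ≡ 0ˢ

{-# OPTIONS --safe #-}
-- Label the steps of the boundary path of D by the sources (rows) and sinks (columns). For a
-- column c, the vector with 1 at the sink of c, 0 at the other sinks and −A(r, c) at the source
-- of each row r lies in V^⊥, and every vector of V^⊥ vanishing at the other sinks is a multiple
-- of it, so its sign vector is a circuit. Two pluses of a row in columns c₁ < c₂ make the circuit
-- of c₁ skip the sink of c₂, and a violation of the L-condition at a 0 in box (r, c) makes the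
-- circuit of c skip the source of r. Conversely, with one plus per row A(r, c) ≠ 0 iff box (r, c)
-- holds a plus, so every circuit has the support of the circuit of some column c: the sink of c
-- and the sources of the rows with a plus in column c. The Le- and L-conditions then force every
-- label skipped strictly inside this support to be the source of an empty row (a coloop) or the
-- sink of an empty column (a loop).

module Submission where

open import Defs
open import Data.Bool using (Bool; true; false; if_then_else_; _∧_)
open import Data.Bool.Properties using (¬-not; T-≡; if-cong; ∧-conicalˡ; ∧-conicalʳ) renaming (_≟_ to _≟ᴮ_)
open import Data.Empty using (⊥)
open import Data.Fin as Fin using (Fin; toℕ; fromℕ<; splitAt; join; punchOut; _<_)
import Data.Fin.Properties as FinP
open import Data.Nat as ℕ using (ℕ; zero; suc; z≤n; s≤s; _≤_; _∸_; _≡ᵇ_; _<ᵇ_)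
import Data.Nat.Properties as ℕP
open import Data.Product using (Σ; _×_; ∃; _,_; proj₁; proj₂)
open import Data.Rational as ℚ using (ℚ; 0ℚ; 1ℚ)
import Data.Rational.Properties as ℚP
open import Algebra.Properties.Group ℚP.+-0-group using (inverseˡ-unique)
open import Data.Sum using (_⊎_; inj₁; inj₂; [_,_]′)
open import Function using (_∘_)
open import Function.Bundles using (_⇔_; mk⇔; Equivalence)
open import Function.Definitions using (Injective)
open import Relation.Binary using (tri<; tri≈; tri>)
open import Relation.Binary.PropositionalEquality
open import Relation.Nullary using (¬_; Dec; yes; no; contradiction)

<ᵇ≡true⇒< : ∀ {m n} → (m <ᵇ n) ≡ true → m ℕ.< n
<ᵇ≡true⇒< {m} {n} e = ℕP.<ᵇ⇒< m n (Equivalence.from T-≡ e)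

<⇒<ᵇ≡true : ∀ {m n} → m ℕ.< n → (m <ᵇ n) ≡ true
<⇒<ᵇ≡true = Equivalence.to T-≡ ∘ ℕP.<⇒<ᵇ

≮⇒<ᵇ≡false : ∀ {m n} → ¬ m ℕ.< n → (m <ᵇ n) ≡ false
≮⇒<ᵇ≡false m≮n = ¬-not (m≮n ∘ <ᵇ≡true⇒<)

≡⇒≡ᵇ≡true : ∀ {m n} → m ≡ n → (m ≡ᵇ n) ≡ true
≡⇒≡ᵇ≡true {m} {n} = Equivalence.to T-≡ ∘ ℕP.≡⇒≡ᵇ m n

≢⇒≡ᵇ≡false : ∀ {m n} → m ≢ n → (m ≡ᵇ n) ≡ false
≢⇒≡ᵇ≡false {m} {n} m≢n = ¬-not (m≢n ∘ ℕP.≡ᵇ⇒≡ m n ∘ Equivalence.from T-≡)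

sumFin-cong : ∀ {m} {f g : Fin m → ℚ} → (∀ j → f j ≡ g j) → sumFin f ≡ sumFin g
sumFin-cong {zero}  f≗g = refl
sumFin-cong {suc m} f≗g = cong₂ ℚ._+_ (f≗g Fin.zero) (sumFin-cong (f≗g ∘ Fin.suc))

sumFin-zero : ∀ {m} {f : Fin m → ℚ} → (∀ j → f j ≡ 0ℚ) → sumFin f ≡ 0ℚ
sumFin-zero {zero}  f≗0 = refl
sumFin-zero {suc m} f≗0 = cong₂ ℚ._+_ (f≗0 Fin.zero) (sumFin-zero (f≗0 ∘ Fin.suc))

sumFin-single : ∀ {m} (f : Fin m → ℚ) p → (∀ j → j ≢ p → f j ≡ 0ℚ) → sumFin f ≡ f p
sumFin-single f Fin.zero    f≗0 =
  trans (cong (f Fin.zero ℚ.+_) (sumFin-zero (λ j → f≗0 (Fin.suc j) λ ()))) (ℚP.+-identityʳ _)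
sumFin-single f (Fin.suc p) f≗0 =
  trans (cong₂ ℚ._+_ (f≗0 Fin.zero λ ())
                     (sumFin-single (f ∘ Fin.suc) p (λ j j≢p → f≗0 (Fin.suc j) (j≢p ∘ FinP.suc-injective))))
        (ℚP.+-identityˡ _)

sumFin-pair : ∀ {m} (f : Fin m → ℚ) p q → p ≢ q → (∀ j → j ≢ p → j ≢ q → f j ≡ 0ℚ) →
              sumFin f ≡ f p ℚ.+ f q
sumFin-pair f Fin.zero    Fin.zero    p≢q f≗0 = contradiction refl p≢q
sumFin-pair f Fin.zero    (Fin.suc q) p≢q f≗0 =
  cong (f Fin.zero ℚ.+_) (sumFin-single (f ∘ Fin.suc) q
    (λ j j≢q → f≗0 (Fin.suc j) (λ ()) (j≢q ∘ FinP.suc-injective)))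
sumFin-pair f (Fin.suc p) Fin.zero    p≢q f≗0 =
  trans (cong (f Fin.zero ℚ.+_) (sumFin-single (f ∘ Fin.suc) p
          (λ j j≢p → f≗0 (Fin.suc j) (j≢p ∘ FinP.suc-injective) (λ ()))))
        (ℚP.+-comm (f Fin.zero) (f (Fin.suc p)))
sumFin-pair f (Fin.suc p) (Fin.suc q) p≢q f≗0 =
  trans (cong₂ ℚ._+_ (f≗0 Fin.zero (λ ()) (λ ()))
                     (sumFin-pair (f ∘ Fin.suc) p q (p≢q ∘ cong Fin.suc)
                       (λ j j≢p j≢q → f≗0 (Fin.suc j) (j≢p ∘ FinP.suc-injective) (j≢q ∘ FinP.suc-injective))))
        (ℚP.+-identityˡ _)

sumFin-*ˡ : ∀ {m} l (f : Fin m → ℚ) → sumFin (λ j → l ℚ.* f j) ≡ l ℚ.* sumFin f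
sumFin-*ˡ {zero}  l f = sym (ℚP.*-zeroʳ l)
sumFin-*ˡ {suc m} l f =
  trans (cong (l ℚ.* f Fin.zero ℚ.+_) (sumFin-*ˡ l (f ∘ Fin.suc))) (sym (ℚP.*-distribˡ-+ l _ _))

sumFinℕ-zero : ∀ {m} (f : Fin m → ℕ) → (∀ j → f j ≡ 0) → sumFinℕ f ≡ 0
sumFinℕ-zero {zero}  f f≗0 = refl
sumFinℕ-zero {suc m} f f≗0 rewrite f≗0 Fin.zero = sumFinℕ-zero (f ∘ Fin.suc) (f≗0 ∘ Fin.suc)

countFin-≤ : ∀ {m} (f : Fin m → Bool) → countFin f ≤ m
countFin-≤ {zero}  f = z≤n
countFin-≤ {suc m} f with f Fin.zero
... | true  = s≤s (countFin-≤ (f ∘ Fin.suc))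
... | false = ℕP.m≤n⇒m≤1+n (countFin-≤ (f ∘ Fin.suc))

countFin-mono : ∀ {m} (f g : Fin m → Bool) → (∀ i → f i ≡ true → g i ≡ true) → countFin f ≤ countFin g
countFin-mono {zero}  f g f⊆g = z≤n
countFin-mono {suc m} f g f⊆g with f Fin.zero in f₀ | g Fin.zero in g₀
... | true  | true  = s≤s (countFin-mono (f ∘ Fin.suc) (g ∘ Fin.suc) (f⊆g ∘ Fin.suc))
... | true  | false = contradiction (trans (sym g₀) (f⊆g Fin.zero f₀)) λ ()
... | false | true  = ℕP.m≤n⇒m≤1+n (countFin-mono (f ∘ Fin.suc) (g ∘ Fin.suc) (f⊆g ∘ Fin.suc))
... | false | false = countFin-mono (f ∘ Fin.suc) (g ∘ Fin.suc) (f⊆g ∘ Fin.suc)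

countFin-prefix : ∀ {m} (f : Fin m → Bool) (r : Fin m) → (∀ s → toℕ s ≤ toℕ r → f s ≡ true) → toℕ r ℕ.< countFin f
countFin-prefix f Fin.zero    f-true rewrite f-true Fin.zero z≤n = s≤s z≤n
countFin-prefix f (Fin.suc r) f-true rewrite f-true Fin.zero z≤n =
  s≤s (countFin-prefix (f ∘ Fin.suc) r (λ s s≤r → f-true (Fin.suc s) (s≤s s≤r)))

countFin-suffix : ∀ {m} (f : Fin m → Bool) (r : Fin m) → (∀ s → toℕ r ≤ toℕ s → f s ≡ false) → countFin f ≤ toℕ r
countFin-suffix f Fin.zero    f-false rewrite f-false Fin.zero z≤n =
  ℕP.≤-reflexive (sumFinℕ-zero _ (λ j → if-cong (f-false (Fin.suc j) z≤n)))
countFin-suffix f (Fin.suc r) f-false with f Fin.zero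
... | true  = s≤s (countFin-suffix (f ∘ Fin.suc) r (λ s r≤s → f-false (Fin.suc s) (s≤s r≤s)))
... | false = ℕP.m≤n⇒m≤1+n (countFin-suffix (f ∘ Fin.suc) r (λ s r≤s → f-false (Fin.suc s) (s≤s r≤s)))

δ : ∀ {m} → Fin m → Fin m → ℚ
δ c c' with c FinP.≟ c'
... | yes _ = 1ℚ
... | no  _ = 0ℚ

δ-same : ∀ {m} (c : Fin m) → δ c c ≡ 1ℚ
δ-same c with c FinP.≟ c
... | yes _   = refl
... | no  c≢c = contradiction refl c≢c

δ-other : ∀ {m} {c c' : Fin m} → c ≢ c' → δ c c' ≡ 0ℚ
δ-other {c = c} {c'} c≢c' with c FinP.≟ c'
... | yes c≡c' = contradiction c≡c' c≢c'
... | no  _    = refl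

injective⇒surjective : ∀ {m n} {f : Fin m → Fin n} → m ≡ n → Injective _≡_ _≡_ f → ∀ j → ∃ λ i → f i ≡ j
injective⇒surjective {zero}          refl f-inj ()
injective⇒surjective {suc m} {f = f} refl f-inj j with FinP.any? (λ i → f i FinP.≟ j)
... | yes hit  = hit
... | no  miss = contradiction (FinP.injective⇒≤ g-injective) ℕP.1+n≰n
  where
  j≢f : ∀ i → j ≢ f i
  j≢f i j≡fi = miss (i , sym j≡fi)

  g : Fin (suc m) → Fin m
  g i = punchOut (j≢f i)

  g-injective : Injective _≡_ _≡_ g
  g-injective {x} {y} e = f-inj (FinP.punchOut-injective (j≢f x) (j≢f y) e)

-- Sign vectors

_·ˢ_ : Sign → Sign → Sign
0ˢ ·ˢ _  = 0ˢ
+ˢ ·ˢ t  = t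
-ˢ ·ˢ 0ˢ = 0ˢ
-ˢ ·ˢ +ˢ = -ˢ
-ˢ ·ˢ -ˢ = +ˢ

·ˢ-zeroʳ : ∀ s → s ·ˢ 0ˢ ≡ 0ˢ
·ˢ-zeroʳ 0ˢ = refl
·ˢ-zeroʳ +ˢ = refl
·ˢ-zeroʳ -ˢ = refl

·ˢ≡0ˢ : ∀ s t → s ·ˢ t ≡ 0ˢ → s ≡ 0ˢ ⊎ t ≡ 0ˢ
·ˢ≡0ˢ 0ˢ t  _ = inj₁ refl
·ˢ≡0ˢ +ˢ t  e = inj₂ e
·ˢ≡0ˢ -ˢ 0ˢ _ = inj₂ refl

·ˢ-identityˡ-unique : ∀ s t → s ·ˢ t ≡ t → t ≢ 0ˢ → s ≡ +ˢ
·ˢ-identityˡ-unique 0ˢ t  e  t≢0 = contradiction (sym e) t≢0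
·ˢ-identityˡ-unique +ˢ t  _  _   = refl
·ˢ-identityˡ-unique -ˢ 0ˢ _  t≢0 = contradiction refl t≢0

sign-pos : ∀ {q} → 0ℚ ℚ.< q → sign q ≡ +ˢ
sign-pos {q} 0<q with q ℚ.≤ᵇ 0ℚ in q≤0
... | true  = contradiction (ℚP.<-≤-trans 0<q (ℚP.≤ᵇ⇒≤ (Equivalence.from T-≡ q≤0))) (ℚP.<-irrefl refl)
... | false = refl

sign-neg : ∀ {q} → q ℚ.< 0ℚ → sign q ≡ -ˢ
sign-neg {q} q<0 rewrite Equivalence.to T-≡ (ℚP.≤⇒≤ᵇ (ℚP.<⇒≤ q<0)) with 0ℚ ℚ.≤ᵇ q in 0≤q
... | true  = contradiction (ℚP.<-≤-trans q<0 (ℚP.≤ᵇ⇒≤ (Equivalence.from T-≡ 0≤q))) (ℚP.<-irrefl refl)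
... | false = refl

sign≡0ˢ⇒≡0 : ∀ {q} → sign q ≡ 0ˢ → q ≡ 0ℚ
sign≡0ˢ⇒≡0 {q} e with ℚP.<-cmp q 0ℚ
... | tri< q<0 _ _ = contradiction (trans (sym (sign-neg q<0)) e) λ ()
... | tri≈ _ q≡0 _ = q≡0
... | tri> _ _ 0<q = contradiction (trans (sym (sign-pos 0<q)) e) λ ()

sign≢0ˢ : ∀ {q} → q ≢ 0ℚ → sign q ≢ 0ˢ
sign≢0ˢ q≢0 = q≢0 ∘ sign≡0ˢ⇒≡0

sign≢0ˢ⇒≢0 : ∀ {q} → sign q ≢ 0ˢ → q ≢ 0ℚ
sign≢0ˢ⇒≢0 sign≢0 refl = sign≢0 refl

sign-* : ∀ p q → sign (p ℚ.* q) ≡ sign p ·ˢ sign q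
sign-* p q with ℚP.<-cmp p 0ℚ | ℚP.<-cmp q 0ℚ
... | tri≈ _ refl _ | _ = cong sign (ℚP.*-zeroˡ q)
... | _ | tri≈ _ refl _ = trans (cong sign (ℚP.*-zeroʳ p)) (sym (·ˢ-zeroʳ (sign p)))
... | tri< p<0 _ _ | tri< q<0 _ _ rewrite sign-neg p<0 | sign-neg q<0 =
  sign-pos {p ℚ.* q} (ℚP.positive⁻¹ (p ℚ.* q) {{ℚP.neg*neg⇒pos p {{ℚ.negative p<0}} q {{ℚ.negative q<0}}}})
... | tri< p<0 _ _ | tri> _ _ 0<q rewrite sign-neg p<0 | sign-pos 0<q =
  sign-neg {p ℚ.* q} (ℚP.negative⁻¹ (p ℚ.* q) {{ℚP.neg*pos⇒neg p {{ℚ.negative p<0}} q {{ℚ.positive 0<q}}}})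
... | tri> _ _ 0<p | tri< q<0 _ _ rewrite sign-pos 0<p | sign-neg q<0 =
  sign-neg {p ℚ.* q} (ℚP.negative⁻¹ (p ℚ.* q) {{ℚP.pos*neg⇒neg p {{ℚ.positive 0<p}} q {{ℚ.negative q<0}}}})
... | tri> _ _ 0<p | tri> _ _ 0<q rewrite sign-pos 0<p | sign-pos 0<q =
  sign-pos {p ℚ.* q} (ℚP.positive⁻¹ (p ℚ.* q) {{ℚP.pos*pos⇒pos p {{ℚ.positive 0<p}} q {{ℚ.positive 0<q}}}})

*-≢0 : ∀ {p q} → p ≢ 0ℚ → q ≢ 0ℚ → p ℚ.* q ≢ 0ℚ
*-≢0 {p} {q} p≢0 q≢0 pq≡0 with ·ˢ≡0ˢ (sign p) (sign q) (trans (sym (sign-* p q)) (cong sign pq≡0))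
... | inj₁ sp≡0 = sign≢0ˢ p≢0 sp≡0
... | inj₂ sq≡0 = sign≢0ˢ q≢0 sq≡0

≤ˢ⇒vanishes : ∀ {n} {τ : SignVec n} {w x : Fin n → ℚ} → (∀ j → sign (w j) ≡ τ j) → τ ≤ˢ (sign ∘ x) →
              ∀ j → x j ≡ 0ℚ → w j ≡ 0ℚ
≤ˢ⇒vanishes {τ = τ} {w} sw τ≤x j xj≡0 with w j ℚP.≟ 0ℚ
... | yes wj≡0 = wj≡0
... | no  wj≢0 = contradiction (trans (τ≤x j τj≢0) (cong sign xj≡0)) τj≢0
  where
  τj≢0 : τ j ≢ 0ˢ
  τj≢0 = sign≢0ˢ wj≢0 ∘ trans (sw j)

≤ˢ-multiple⇒≡ : ∀ {n} (l : ℚ) (x : Fin n → ℚ) (τ : SignVec n) → (∀ j → τ j ≡ sign (l ℚ.* x j)) →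
                NonZero τ → τ ≤ˢ (sign ∘ x) → ∀ j → τ j ≡ sign (x j)
≤ˢ-multiple⇒≡ l x τ τ≡lx (i , τi≢0) τ≤x j =
  trans (τ≡lx j) (trans (sign-* l (x j)) (cong (_·ˢ sign (x j)) sign-l≡+))
  where
  sign-l≡+ : sign l ≡ +ˢ
  sign-l≡+ = ·ˢ-identityˡ-unique (sign l) (sign (x i))
    (trans (sym (sign-* l (x i))) (trans (sym (τ≡lx i)) (τ≤x i τi≢0)))
    (τi≢0 ∘ trans (τ≤x i τi≢0))

-- Pluses and paths of a Le-diagram

module _ {k n : ℕ} (D : LeDiagram k n) where

  Plus : Fin k → ℕ → Set
  Plus r c = isPlus D r c ≡ true

  Plus? : ∀ r c → Dec (Plus r c)
  Plus? r c = isPlus D r c ≟ᴮ true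

  plus⇒<shape : ∀ {r c} → Plus r c → c ℕ.< shape D r
  plus⇒<shape p = <ᵇ≡true⇒< (∧-conicalˡ _ _ p)

  plus⇒fill : ∀ {r c} → Plus r c → fill D r c ≡ true
  plus⇒fill p = ∧-conicalʳ _ _ p

  plus-intro : ∀ {r c} → c ℕ.< shape D r → fill D r c ≡ true → Plus r c
  plus-intro c<sh f rewrite <⇒<ᵇ≡true c<sh = f

  zero⇒¬plus : ∀ {r c} → fill D r c ≡ false → ¬ Plus r c
  zero⇒¬plus f p = contradiction (trans (sym f) (plus⇒fill p)) λ ()

  ¬plus⇒zero : ∀ {r c} → c ℕ.< shape D r → ¬ Plus r c → fill D r c ≡ false
  ¬plus⇒zero c<sh ¬p = ¬-not (¬p ∘ plus-intro c<sh)

  plus≢nonplus : ∀ {r c c'} → Plus r c → ¬ Plus r c' → c ≢ c'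
  plus≢nonplus r∋c r∌c' refl = r∌c' r∋c

  westPaths-plus : ∀ {r t} → Plus r t → ∀ b → t ℕ.< b → 1 ≤ westPaths D t b r
  westPaths-plus {r} {t} p (suc b) t<1+b with ℕP.m≤n⇒m<n∨m≡n (ℕ.s≤s⁻¹ t<1+b)
  ... | inj₁ t<b  = ℕP.≤-trans (westPaths-plus p b t<b) (ℕP.m≤m+n _ _)
  ... | inj₂ refl rewrite p | ≡⇒≡ᵇ≡true {t} refl =
    ℕP.≤-trans (s≤s z≤n) (ℕP.m≤n+m _ (westPaths D t t r))

  numPaths-plus : ∀ {r t} → Plus r t → 1 ≤ numPaths D r t
  numPaths-plus {r} p = westPaths-plus p (n ∸ k) (ℕP.<-≤-trans (plus⇒<shape p) (shape-bound D r))

  -- With one plus per row, a path turns south only at the plus of its row; once it turns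
  -- west again it meets no further plus, so it can end only at the sink of that plus.
  westPaths-zero : AtMostOnePlusPerRow D → ∀ {t} b r → ¬ Plus r t → westPaths D t b r ≡ 0
  westPaths-zero amo       zero    r r∌t = refl
  westPaths-zero amo {t} (suc b) r r∌t with isPlus D r b in r∋b
  ... | false rewrite westPaths-zero amo b r r∌t = refl
  ... | true  rewrite westPaths-zero amo b r r∌t | ≢⇒≡ᵇ≡false (plus≢nonplus r∋b r∌t) =
    sumFinℕ-zero _ turnWest
    where
    turnWest : ∀ r' → (if (toℕ r <ᵇ toℕ r') ∧ isPlus D r' b then westPaths D t b r' else 0) ≡ 0
    turnWest r' with toℕ r <ᵇ toℕ r' | isPlus D r' b in r'∋b
    ... | false | _     = refl
    ... | true  | false = refl
    ... | true  | true  = westPaths-zero amo b r' (plus≢nonplus r∋b r∌t ∘ amo r' b t r'∋b)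

  numPaths-zero : AtMostOnePlusPerRow D → ∀ {r t} → ¬ Plus r t → numPaths D r t ≡ 0
  numPaths-zero amo {r} = westPaths-zero amo (n ∸ k) r

  zero-below-plus⇒empty-row : LCondition D → ∀ {r s c c'} →
    Plus r c → toℕ r ℕ.< toℕ s → c ℕ.< shape D s → ¬ Plus s c → ¬ Plus s c'
  zero-below-plus⇒empty-row lc {r} {s} {c} {c'} r∋c r<s c<sh s∌c s∋c' with ℕP.<-cmp c' c
  ... | tri< c'<c _ _ =
    le-cond D s c c<sh (¬plus⇒zero c<sh s∌c) (r , c' , r<s , plus⇒fill r∋c , c'<c , plus⇒fill s∋c')
  ... | tri≈ _ refl _ = s∌c s∋c'
  ... | tri> _ _ c<c' = lc s c c<sh (¬plus⇒zero c<sh s∌c) (r , c' , r<s , plus⇒fill r∋c , c<c' , s∋c')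

  zero-right-of-plus⇒empty-column : AtMostOnePlusPerRow D → LCondition D → ∀ {r r' c c'} →
    Plus r c → c ℕ.< c' → c' ℕ.< shape D r → ¬ Plus r' c'
  zero-right-of-plus⇒empty-column amo lc {r} {r'} {c} {c'} r∋c c<c' c'<sh r'∋c'
    with ℕP.<-cmp (toℕ r') (toℕ r)
  ... | tri< r'<r _ _ =
    le-cond D r c' c'<sh (¬plus⇒zero c'<sh (ℕP.<⇒≢ c<c' ∘ amo r c c' r∋c))
      (r' , c , r'<r , plus⇒fill r'∋c' , c<c' , plus⇒fill r∋c)
  ... | tri≈ _ r'≡r _ =
    ℕP.<⇒≢ c<c' (amo r c c' r∋c (subst (λ x → Plus x c') (FinP.toℕ-injective r'≡r) r'∋c'))
  ... | tri> _ _ r<r' with Plus? r' c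
  ...   | yes r'∋c = ℕP.<⇒≢ c<c' (amo r' c c' r'∋c r'∋c')
  ...   | no  r'∌c = lc r' c c<sh' (¬plus⇒zero c<sh' r'∌c) (r , c' , r<r' , plus⇒fill r∋c , c<c' , r'∋c')
    where
    c<sh' : c ℕ.< shape D r'
    c<sh' = ℕP.<-trans c<c' (plus⇒<shape r'∋c')

  CircuitWithGap : Set
  CircuitWithGap = Σ (SignVec n) λ σ → Σ (Fin n) λ a → Σ (Fin n) λ b → Σ (Fin n) λ c →
    Circuit D σ × a < b × b < c × σ a ≢ 0ˢ × σ c ≢ 0ˢ × σ b ≡ 0ˢ × ¬ Loop D b × ¬ Coloop D b

module Network {k n : ℕ} (k≤n : k ≤ n) (D : LeDiagram k n) where

  m : ℕ
  m = n ∸ k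

  colLen-antimono : ∀ {c c'} → c ≤ c' → colLen D c' ≤ colLen D c
  colLen-antimono {c} {c'} c≤c' = countFin-mono (λ r → c' <ᵇ shape D r) (λ r → c <ᵇ shape D r)
    (λ r c'<sh → <⇒<ᵇ≡true (ℕP.≤-<-trans c≤c' (<ᵇ≡true⇒< {c'} {shape D r} c'<sh)))

  <shape⇒<colLen : ∀ {r c} → c ℕ.< shape D r → toℕ r ℕ.< colLen D c
  <shape⇒<colLen {r} c<sh =
    countFin-prefix _ r (λ s s≤r → <⇒<ᵇ≡true (ℕP.<-≤-trans c<sh (shape-mono D s r s≤r)))

  shape≤⇒colLen≤ : ∀ {r c} → shape D r ≤ c → colLen D c ≤ toℕ r
  shape≤⇒colLen≤ {r} sh≤c =
    countFin-suffix _ r (λ s r≤s → ≮⇒<ᵇ≡false (λ c<sh → ℕP.<⇒≱ c<sh (ℕP.≤-trans (shape-mono D r s r≤s) sh≤c)))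

  rowLabel-mono : ∀ {r s} → toℕ r ℕ.< toℕ s → rowLabel D r ℕ.< rowLabel D s
  rowLabel-mono {r} {s} r<s = ℕP.+-mono-≤-< (ℕP.∸-monoʳ-≤ m (shape-mono D r s (ℕP.<⇒≤ r<s))) r<s

  colLabel-antimono : ∀ {c c'} → c ℕ.< c' → c' ℕ.< m → colLabel D c' ℕ.< colLabel D c
  colLabel-antimono c<c' c'<m =
    ℕP.+-mono-<-≤ (ℕP.∸-monoʳ-< (s≤s c<c') c'<m) (colLen-antimono (ℕP.<⇒≤ c<c'))

  rowLabel<colLabel : ∀ {r c} → c ℕ.< shape D r → rowLabel D r ℕ.< colLabel D c
  rowLabel<colLabel c<sh = ℕP.+-mono-≤-< (ℕP.∸-monoʳ-≤ m c<sh) (<shape⇒<colLen c<sh)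

  colLabel<rowLabel : ∀ {r c} → c ℕ.< m → shape D r ≤ c → colLabel D c ℕ.< rowLabel D r
  colLabel<rowLabel c<m sh≤c = ℕP.+-mono-<-≤ (ℕP.∸-monoʳ-< (s≤s sh≤c) c<m) (shape≤⇒colLen≤ sh≤c)

  rowLabel<n : ∀ r → rowLabel D r ℕ.< n
  rowLabel<n r = subst (rowLabel D r ℕ.<_) (ℕP.m∸n+n≡m k≤n)
    (ℕP.+-mono-≤-< (ℕP.m∸n≤m m (shape D r)) (FinP.toℕ<n r))

  colLabel<n : ∀ {c} → c ℕ.< m → colLabel D c ℕ.< n
  colLabel<n {c} c<m = subst (colLabel D c ℕ.<_) (ℕP.m∸n+n≡m k≤n)
    (ℕP.+-mono-<-≤ (ℕP.∸-monoʳ-< (s≤s z≤n) c<m) (countFin-≤ (λ r → c <ᵇ shape D r)))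

  src : Fin k → Fin n
  src r = fromℕ< (rowLabel<n r)

  snk : Fin m → Fin n
  snk c = fromℕ< (colLabel<n (FinP.toℕ<n c))

  toℕ-src : ∀ r → toℕ (src r) ≡ rowLabel D r
  toℕ-src r = FinP.toℕ-fromℕ< (rowLabel<n r)

  toℕ-snk : ∀ c → toℕ (snk c) ≡ colLabel D (toℕ c)
  toℕ-snk c = FinP.toℕ-fromℕ< (colLabel<n (FinP.toℕ<n c))

  src-mono-< : ∀ {r s} → toℕ r ℕ.< toℕ s → src r < src s
  src-mono-< {r} {s} r<s = subst₂ ℕ._<_ (sym (toℕ-src r)) (sym (toℕ-src s)) (rowLabel-mono r<s)

  snk-antimono-< : ∀ {c c' : Fin m} → toℕ c ℕ.< toℕ c' → snk c' < snk c
  snk-antimono-< {c} {c'} c<c' =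
    subst₂ ℕ._<_ (sym (toℕ-snk c')) (sym (toℕ-snk c)) (colLabel-antimono c<c' (FinP.toℕ<n c'))

  src<snk : ∀ {r} {c : Fin m} → toℕ c ℕ.< shape D r → src r < snk c
  src<snk {r} {c} c<sh = subst₂ ℕ._<_ (sym (toℕ-src r)) (sym (toℕ-snk c)) (rowLabel<colLabel c<sh)

  snk<src : ∀ {r} {c : Fin m} → shape D r ≤ toℕ c → snk c < src r
  snk<src {r} {c} sh≤c =
    subst₂ ℕ._<_ (sym (toℕ-snk c)) (sym (toℕ-src r)) (colLabel<rowLabel (FinP.toℕ<n c) sh≤c)

  src-cancel-< : ∀ {r s} → src r < src s → toℕ r ℕ.< toℕ s
  src-cancel-< {r} {s} lt with ℕP.<-cmp (toℕ r) (toℕ s)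
  ... | tri< r<s _ _ = r<s
  ... | tri≈ _ r≡s _ = contradiction (cong src (FinP.toℕ-injective r≡s)) (FinP.<⇒≢ lt)
  ... | tri> _ _ s<r = contradiction lt (ℕP.<-asym (src-mono-< s<r))

  snk-cancel-< : ∀ {c c' : Fin m} → snk c' < snk c → toℕ c ℕ.< toℕ c'
  snk-cancel-< {c} {c'} lt with ℕP.<-cmp (toℕ c) (toℕ c')
  ... | tri< c<c' _ _ = c<c'
  ... | tri≈ _ c≡c' _ = contradiction (cong snk (FinP.toℕ-injective c≡c')) (FinP.<⇒≢ lt ∘ sym)
  ... | tri> _ _ c'<c = contradiction lt (ℕP.<-asym (snk-antimono-< c'<c))

  src<snk⇒<shape : ∀ {r} {c : Fin m} → src r < snk c → toℕ c ℕ.< shape D r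
  src<snk⇒<shape {r} {c} lt with toℕ c ℕP.<? shape D r
  ... | yes c<sh = c<sh
  ... | no  c≮sh = contradiction lt (ℕP.<-asym (snk<src (ℕP.≮⇒≥ c≮sh)))

  src-injective : ∀ {r s} → src r ≡ src s → r ≡ s
  src-injective {r} {s} e with ℕP.<-cmp (toℕ r) (toℕ s)
  ... | tri< r<s _ _ = contradiction e (FinP.<⇒≢ (src-mono-< r<s))
  ... | tri≈ _ r≡s _ = FinP.toℕ-injective r≡s
  ... | tri> _ _ s<r = contradiction (sym e) (FinP.<⇒≢ (src-mono-< s<r))

  snk-injective : ∀ {c c'} → snk c ≡ snk c' → c ≡ c'
  snk-injective {c} {c'} e with ℕP.<-cmp (toℕ c) (toℕ c')
  ... | tri< c<c' _ _ = contradiction (sym e) (FinP.<⇒≢ (snk-antimono-< c<c'))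
  ... | tri≈ _ c≡c' _ = FinP.toℕ-injective c≡c'
  ... | tri> _ _ c'<c = contradiction e (FinP.<⇒≢ (snk-antimono-< c'<c))

  src≢snk : ∀ {r c} → src r ≢ snk c
  src≢snk {r} {c} e with toℕ c ℕP.<? shape D r
  ... | yes c<sh = FinP.<⇒≢ (src<snk c<sh) e
  ... | no  c≮sh = FinP.<⇒≢ (snk<src (ℕP.≮⇒≥ c≮sh)) (sym e)

  label : Fin k ⊎ Fin m → Fin n
  label = [ src , snk ]′

  label-injective : Injective _≡_ _≡_ label
  label-injective {inj₁ r} {inj₁ s}  e = cong inj₁ (src-injective e)
  label-injective {inj₁ r} {inj₂ c}  e = contradiction e src≢snk
  label-injective {inj₂ c} {inj₁ r}  e = contradiction (sym e) src≢snk
  label-injective {inj₂ c} {inj₂ c'} e = cong inj₂ (snk-injective e)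

  label∘splitAt-injective : Injective _≡_ _≡_ (label ∘ splitAt k)
  label∘splitAt-injective {x} {y} e = trans (sym (FinP.join-splitAt k m x))
    (trans (cong (join k m) (label-injective {splitAt k x} {splitAt k y} e)) (FinP.join-splitAt k m y))

  label-surjective : ∀ j → ∃ λ l → label l ≡ j
  label-surjective j with injective⇒surjective (ℕP.m+[n∸m]≡n k≤n) label∘splitAt-injective j
  ... | i , e = splitAt k i , e

  classify : ∀ j → (∃ λ r → j ≡ src r) ⊎ (∃ λ c → j ≡ snk c)
  classify j with label-surjective j
  ... | inj₁ r , e = inj₁ (r , sym e)
  ... | inj₂ c , e = inj₂ (c , sym e)

  label-elim : ∀ {ℓ} (P : Fin n → Set ℓ) → (∀ r → P (src r)) → (∀ c → P (snk c)) → ∀ j → P j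
  label-elim P onSrc onSnk j with classify j
  ... | inj₁ (r , refl) = onSrc r
  ... | inj₂ (c , refl) = onSnk c

  glue : ∀ {A : Set} → (Fin k → A) → (Fin m → A) → Fin n → A
  glue x y j = [ x ∘ proj₁ , y ∘ proj₁ ]′ (classify j)

  glue-src : ∀ {A : Set} (x : Fin k → A) (y : Fin m → A) r → glue x y (src r) ≡ x r
  glue-src x y r with classify (src r)
  ... | inj₁ (r' , e) = cong x (sym (src-injective e))
  ... | inj₂ (c  , e) = contradiction e src≢snk

  glue-snk : ∀ {A : Set} (x : Fin k → A) (y : Fin m → A) c → glue x y (snk c) ≡ y c
  glue-snk x y c with classify (snk c)
  ... | inj₁ (r  , e) = contradiction (sym e) src≢snk
  ... | inj₂ (c' , e) = cong y (sym (snk-injective e))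

  -- The matrix and its fundamental circuits

  A : Fin k → Fin n → ℚ
  A = matrixA D

  toℕ-src≢colLabel : ∀ {r} c → toℕ (src r) ≢ colLabel D (toℕ c)
  toℕ-src≢colLabel c e = src≢snk (FinP.toℕ-injective (trans e (sym (toℕ-snk c))))

  matrixA-src : ∀ r s → A r (src s) ≡ (if toℕ (src s) ≡ᵇ rowLabel D r then 1ℚ else 0ℚ)
  matrixA-src r s =
    trans (cong ((if toℕ (src s) ≡ᵇ rowLabel D r then 1ℚ else 0ℚ) ℚ.+_)
                (sumFin-zero (λ c → if-cong (≢⇒≡ᵇ≡false (toℕ-src≢colLabel c)))))
          (ℚP.+-identityʳ _)

  matrixA-src-self : ∀ r → A r (src r) ≡ 1ℚ
  matrixA-src-self r = trans (matrixA-src r r) (if-cong (≡⇒≡ᵇ≡true (toℕ-src r)))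

  matrixA-src-other : ∀ {r s} → r ≢ s → A r (src s) ≡ 0ℚ
  matrixA-src-other {r} {s} r≢s = trans (matrixA-src r s) (if-cong (≢⇒≡ᵇ≡false srcs≢r))
    where
    srcs≢r : toℕ (src s) ≢ rowLabel D r
    srcs≢r e = r≢s (src-injective (FinP.toℕ-injective (trans (toℕ-src r) (sym e))))

  matrixA-snk : ∀ r c →
    A r (snk c) ≡ altSign D (sgnExp D (rowLabel D r) (toℕ (snk c))) ℚ.* ℕtoℚ D (numPaths D r (toℕ c))
  matrixA-snk r c =
    trans (cong₂ ℚ._+_ (if-cong (≢⇒≡ᵇ≡false snkc≢r)) (sumFin-single _ c other))
          (trans (ℚP.+-identityˡ _) (if-cong (≡⇒≡ᵇ≡true (toℕ-snk c))))
    where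
    snkc≢r : toℕ (snk c) ≢ rowLabel D r
    snkc≢r e = toℕ-src≢colLabel c (trans (toℕ-src r) (trans (sym e) (toℕ-snk c)))

    other : ∀ c' → c' ≢ c → (if toℕ (snk c) ≡ᵇ colLabel D (toℕ c')
                                then altSign D (sgnExp D (rowLabel D r) (toℕ (snk c))) ℚ.*
                                     ℕtoℚ D (numPaths D r (toℕ c'))
                                else 0ℚ) ≡ 0ℚ
    other c' c'≢c = if-cong (≢⇒≡ᵇ≡false (λ e →
      c'≢c (sym (snk-injective (FinP.toℕ-injective (trans e (sym (toℕ-snk c'))))))))

  altSign≢0 : ∀ s → altSign D s ≢ 0ℚ
  altSign≢0 zero    = ℚP.1≢0
  altSign≢0 (suc s) = altSign≢0 s ∘ ℚP.neg-injective

  ℕtoℚ-suc≢0 : ∀ p → ℕtoℚ D (suc p) ≢ 0ℚ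
  ℕtoℚ-suc≢0 p e = ℚP.<-irrefl (sym e) (ℚP.positive⁻¹ (ℕtoℚ D (suc p)) {{ℚP.normalize-pos (suc p) 1}})

  matrixA-snk≢0 : ∀ {r c} → Plus D r (toℕ c) → A r (snk c) ≢ 0ℚ
  matrixA-snk≢0 {r} {c} r∋c rewrite matrixA-snk r c with numPaths D r (toℕ c) | numPaths-plus D r∋c
  ... | suc p | _ = *-≢0 (altSign≢0 (sgnExp D (rowLabel D r) (toℕ (snk c)))) (ℕtoℚ-suc≢0 p)

  matrixA-snk≡0 : AtMostOnePlusPerRow D → ∀ {r c} → ¬ Plus D r (toℕ c) → A r (snk c) ≡ 0ℚ
  matrixA-snk≡0 amo {r} {c} r∌c rewrite matrixA-snk r c | numPaths-zero D amo r∌c =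
    ℚP.*-zeroʳ (altSign D (sgnExp D (rowLabel D r) (toℕ (snk c))))

  rowProduct : Fin k → (Fin n → ℚ) → ℚ
  rowProduct r w = sumFin (λ j → A r j ℚ.* w j)

  diagonal-term : ∀ r (w : Fin n → ℚ) → A r (src r) ℚ.* w (src r) ≡ w (src r)
  diagonal-term r w = trans (cong (ℚ._* w (src r)) (matrixA-src-self r)) (ℚP.*-identityˡ (w (src r)))

  off-diagonal-term : ∀ {r s} (w : Fin n → ℚ) → r ≢ s → A r (src s) ℚ.* w (src s) ≡ 0ℚ
  off-diagonal-term {s = s} w r≢s = trans (cong (ℚ._* w (src s)) (matrixA-src-other r≢s)) (ℚP.*-zeroˡ (w (src s)))

  rowProduct-src : ∀ r (w : Fin n → ℚ) → (∀ c → A r (snk c) ℚ.* w (snk c) ≡ 0ℚ) → rowProduct r w ≡ w (src r)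
  rowProduct-src r w sinks≡0 = trans (sumFin-single _ (src r) other) (diagonal-term r w)
    where
    other : ∀ j → j ≢ src r → A r j ℚ.* w j ≡ 0ℚ
    other = label-elim _ (λ s s≢r → off-diagonal-term w (s≢r ∘ cong src ∘ sym)) (λ c _ → sinks≡0 c)

  rowProduct-src-snk : ∀ r c (w : Fin n → ℚ) → (∀ c' → c' ≢ c → A r (snk c') ℚ.* w (snk c') ≡ 0ℚ) →
                       rowProduct r w ≡ w (src r) ℚ.+ A r (snk c) ℚ.* w (snk c)
  rowProduct-src-snk r c w sinks≡0 =
    trans (sumFin-pair _ (src r) (snk c) src≢snk other) (cong (ℚ._+ A r (snk c) ℚ.* w (snk c)) (diagonal-term r w))
    where
    other : ∀ j → j ≢ src r → j ≢ snk c → A r j ℚ.* w j ≡ 0ℚ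
    other = label-elim _ (λ s s≢r _ → off-diagonal-term w (s≢r ∘ cong src ∘ sym))
                         (λ c' _ c'≢c → sinks≡0 c' (c'≢c ∘ cong snk))

  InVperp-scale : ∀ l {w} → InVperp D w → InVperp D (λ j → l ℚ.* w j)
  InVperp-scale l {w} w∈V⊥ r = begin
    rowProduct r (λ j → l ℚ.* w j)        ≡⟨ sumFin-cong (λ j → swap (A r j) (w j)) ⟩
    sumFin (λ j → l ℚ.* (A r j ℚ.* w j))  ≡⟨ sumFin-*ˡ l (λ j → A r j ℚ.* w j) ⟩
    l ℚ.* rowProduct r w                  ≡⟨ cong (l ℚ.*_) (w∈V⊥ r) ⟩
    l ℚ.* 0ℚ                              ≡⟨ ℚP.*-zeroʳ l ⟩
    0ℚ                                    ∎
    where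
    open ≡-Reasoning
    swap : ∀ a x → a ℚ.* (l ℚ.* x) ≡ l ℚ.* (a ℚ.* x)
    swap a x = trans (sym (ℚP.*-assoc a l x)) (trans (cong (ℚ._* x) (ℚP.*-comm a l)) (ℚP.*-assoc l a x))

  fundamental : Fin m → Fin n → ℚ
  fundamental c = glue (λ r → ℚ.- A r (snk c)) (δ c)

  fundamentalSign : Fin m → SignVec n
  fundamentalSign c = sign ∘ fundamental c

  fundamental-src : ∀ c r → fundamental c (src r) ≡ ℚ.- A r (snk c)
  fundamental-src c = glue-src _ (δ c)

  fundamental-snk-self : ∀ c → fundamental c (snk c) ≡ 1ℚ
  fundamental-snk-self c = trans (glue-snk _ (δ c) c) (δ-same c)

  fundamental-snk-other : ∀ {c c'} → c ≢ c' → fundamental c (snk c') ≡ 0ℚ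
  fundamental-snk-other {c} {c'} c≢c' = trans (glue-snk _ (δ c) c') (δ-other c≢c')

  fundamental-snk≢0 : ∀ c → fundamental c (snk c) ≢ 0ℚ
  fundamental-snk≢0 c = ℚP.1≢0 ∘ trans (sym (fundamental-snk-self c))

  fundamental-src≢0 : ∀ {r c} → Plus D r (toℕ c) → fundamental c (src r) ≢ 0ℚ
  fundamental-src≢0 {r} {c} r∋c = matrixA-snk≢0 r∋c ∘ ℚP.neg-injective ∘ trans (sym (fundamental-src c r))

  fundamental-src≡0 : AtMostOnePlusPerRow D → ∀ {r c} → ¬ Plus D r (toℕ c) → fundamental c (src r) ≡ 0ℚ
  fundamental-src≡0 amo {r} {c} r∌c = trans (fundamental-src c r) (cong ℚ.-_ (matrixA-snk≡0 amo r∌c))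

  fundamental-InVperp : ∀ c → InVperp D (fundamental c)
  fundamental-InVperp c r = begin
    rowProduct r (fundamental c)
      ≡⟨ rowProduct-src-snk r c _ other ⟩
    fundamental c (src r) ℚ.+ A r (snk c) ℚ.* fundamental c (snk c)
      ≡⟨ cong₂ (λ x y → x ℚ.+ A r (snk c) ℚ.* y) (fundamental-src c r) (fundamental-snk-self c) ⟩
    ℚ.- A r (snk c) ℚ.+ A r (snk c) ℚ.* 1ℚ
      ≡⟨ cong (ℚ.- A r (snk c) ℚ.+_) (ℚP.*-identityʳ (A r (snk c))) ⟩
    ℚ.- A r (snk c) ℚ.+ A r (snk c)
      ≡⟨ ℚP.+-inverseˡ (A r (snk c)) ⟩
    0ℚ ∎
    where
    open ≡-Reasoning
    other : ∀ c' → c' ≢ c → A r (snk c') ℚ.* fundamental c (snk c') ≡ 0ℚ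
    other c' c'≢c =
      trans (cong (A r (snk c') ℚ.*_) (fundamental-snk-other (c'≢c ∘ sym))) (ℚP.*-zeroʳ (A r (snk c')))

  InVperp-src : ∀ {w} → InVperp D w → ∀ r c → (∀ c' → c' ≢ c → A r (snk c') ℚ.* w (snk c') ≡ 0ℚ) →
                w (src r) ≡ w (snk c) ℚ.* fundamental c (src r)
  InVperp-src {w} w∈V⊥ r c sinks≡0 = begin
    w (src r)                            ≡⟨ inverseˡ-unique _ _ rowProduct≡0 ⟩
    ℚ.- (A r (snk c) ℚ.* w (snk c))      ≡⟨ cong ℚ.-_ (ℚP.*-comm (A r (snk c)) (w (snk c))) ⟩
    ℚ.- (w (snk c) ℚ.* A r (snk c))      ≡⟨ ℚP.neg-distribʳ-* (w (snk c)) (A r (snk c)) ⟩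
    w (snk c) ℚ.* ℚ.- A r (snk c)        ≡⟨ cong (w (snk c) ℚ.*_) (fundamental-src c r) ⟨
    w (snk c) ℚ.* fundamental c (src r)  ∎
    where
    open ≡-Reasoning
    rowProduct≡0 : w (src r) ℚ.+ A r (snk c) ℚ.* w (snk c) ≡ 0ℚ
    rowProduct≡0 = trans (sym (rowProduct-src-snk r c w sinks≡0)) (w∈V⊥ r)

  scale-fundamental-snk-self : ∀ l c → l ≡ l ℚ.* fundamental c (snk c)
  scale-fundamental-snk-self l c = sym (trans (cong (l ℚ.*_) (fundamental-snk-self c)) (ℚP.*-identityʳ l))

  InVperp-multiple-of-fundamental : ∀ {w} c → InVperp D w → (∀ c' → c' ≢ c → w (snk c') ≡ 0ℚ) →
                                    ∀ j → w j ≡ w (snk c) ℚ.* fundamental c j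
  InVperp-multiple-of-fundamental {w} c w∈V⊥ vanish = label-elim _ atSrc atSnk
    where
    atSrc : ∀ r → w (src r) ≡ w (snk c) ℚ.* fundamental c (src r)
    atSrc r = InVperp-src w∈V⊥ r c λ c' c'≢c →
      trans (cong (A r (snk c') ℚ.*_) (vanish c' c'≢c)) (ℚP.*-zeroʳ (A r (snk c')))

    atSnk : ∀ c' → w (snk c') ≡ w (snk c) ℚ.* fundamental c (snk c')
    atSnk c' with c' FinP.≟ c
    ... | yes refl = scale-fundamental-snk-self (w (snk c)) c
    ... | no  c'≢c = trans (vanish c' c'≢c) (sym (trans (cong (w (snk c) ℚ.*_) (fundamental-snk-other (c'≢c ∘ sym)))
                                                        (ℚP.*-zeroʳ (w (snk c)))))

  fundamental-circuit : ∀ c → Circuit D (fundamentalSign c)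
  fundamental-circuit c =
    (fundamental c , fundamental-InVperp c , λ _ → refl) , (snk c , sign≢0ˢ (fundamental-snk≢0 c)) , minimal
    where
    minimal : ∀ τ → InV D τ → NonZero τ → τ ≤ˢ fundamentalSign c → ∀ i → τ i ≡ fundamentalSign c i
    minimal τ (w , w∈V⊥ , sw) τ≢0 τ≤ = ≤ˢ-multiple⇒≡ (w (snk c)) (fundamental c) τ τ≡ τ≢0 τ≤
      where
      vanish : ∀ c' → c' ≢ c → w (snk c') ≡ 0ℚ
      vanish c' c'≢c = ≤ˢ⇒vanishes {w = w} {x = fundamental c} sw τ≤ (snk c') (fundamental-snk-other (c'≢c ∘ sym))

      τ≡ : ∀ j → τ j ≡ sign (w (snk c) ℚ.* fundamental c j)
      τ≡ j = trans (sym (sw j)) (cong sign (InVperp-multiple-of-fundamental c w∈V⊥ vanish j))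

  matrixA≢0⇒¬Loop : ∀ {r j} → A r j ≢ 0ℚ → ¬ Loop D j
  matrixA≢0⇒¬Loop {r} {j} Arj≢0 (w , w∈V⊥ , sw) =
    *-≢0 Arj≢0 wj≢0 (trans (sym (sumFin-single _ j other)) (w∈V⊥ r))
    where
    unitSign-self : unitSign D j j ≡ +ˢ
    unitSign-self = if-cong (≡⇒≡ᵇ≡true {toℕ j} refl)

    wj≢0 : w j ≢ 0ℚ
    wj≢0 wj≡0 = contradiction (trans (sym (cong sign wj≡0)) (trans (sw j) unitSign-self)) λ ()

    other : ∀ i → i ≢ j → A r i ℚ.* w i ≡ 0ℚ
    other i i≢j = trans (cong (A r i ℚ.*_) (sign≡0ˢ⇒≡0 (trans (sw i) (if-cong (≢⇒≡ᵇ≡false j≢i)))))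
                        (ℚP.*-zeroʳ (A r i))
      where
      j≢i : toℕ j ≢ toℕ i
      j≢i = i≢j ∘ sym ∘ FinP.toℕ-injective

  fundamental≢0⇒¬Coloop : ∀ {c j} → fundamental c j ≢ 0ℚ → ¬ Coloop D j
  fundamental≢0⇒¬Coloop {c} fv≢0 coloop =
    sign≢0ˢ fv≢0 (coloop (fundamentalSign c) (fundamental c , fundamental-InVperp c , λ _ → refl))

  -- One plus per row

  module _ (amo : AtMostOnePlusPerRow D) where

    emptyColumn⇒Loop : ∀ c → (∀ r → ¬ Plus D r (toℕ c)) → Loop D (snk c)
    emptyColumn⇒Loop c empty = e , e∈V⊥ , sign-e
      where
      e : Fin n → ℚ
      e i = if toℕ (snk c) ≡ᵇ toℕ i then 1ℚ else 0ℚ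

      sign-e : ∀ i → sign (e i) ≡ unitSign D (snk c) i
      sign-e i with toℕ (snk c) ≡ᵇ toℕ i
      ... | true  = refl
      ... | false = refl

      e∈V⊥ : InVperp D e
      e∈V⊥ r = trans (sumFin-single _ (snk c) other)
                     (trans (cong (ℚ._* e (snk c)) (matrixA-snk≡0 amo (empty r))) (ℚP.*-zeroˡ (e (snk c))))
        where
        other : ∀ i → i ≢ snk c → A r i ℚ.* e i ≡ 0ℚ
        other i i≢c = trans (cong (A r i ℚ.*_) (if-cong (≢⇒≡ᵇ≡false (i≢c ∘ sym ∘ FinP.toℕ-injective))))
                            (ℚP.*-zeroʳ (A r i))

    InVperp-emptyRow : ∀ {w} → InVperp D w → ∀ s → (∀ c → ¬ Plus D s (toℕ c)) → w (src s) ≡ 0ℚ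
    InVperp-emptyRow {w} w∈V⊥ s empty = trans (sym (rowProduct-src s w sinks≡0)) (w∈V⊥ s)
      where
      sinks≡0 : ∀ c → A s (snk c) ℚ.* w (snk c) ≡ 0ℚ
      sinks≡0 c = trans (cong (ℚ._* w (snk c)) (matrixA-snk≡0 amo (empty c))) (ℚP.*-zeroˡ (w (snk c)))

    emptyRow⇒Coloop : ∀ s → (∀ c → ¬ Plus D s (toℕ c)) → Coloop D (src s)
    emptyRow⇒Coloop s empty σ (w , w∈V⊥ , sw) = trans (sym (sw (src s))) (cong sign (InVperp-emptyRow w∈V⊥ s empty))

    ¬Loop⇒plusInColumn : ∀ c → ¬ Loop D (snk c) → ∃ λ r → Plus D r (toℕ c)
    ¬Loop⇒plusInColumn c ¬loop with FinP.any? (λ r → Plus? D r (toℕ c))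
    ... | yes plus = plus
    ... | no  none = contradiction (emptyColumn⇒Loop c (λ r r∋c → none (r , r∋c))) ¬loop

    ¬Coloop⇒plusInRow : ∀ s → ¬ Coloop D (src s) → ∃ λ c → Plus D s (toℕ c)
    ¬Coloop⇒plusInRow s ¬coloop with FinP.any? (λ c → Plus? D s (toℕ c))
    ... | yes plus = plus
    ... | no  none = contradiction (emptyRow⇒Coloop s (λ c s∋c → none (c , s∋c))) ¬coloop

    InVperp-plus : ∀ {w r c} → InVperp D w → Plus D r (toℕ c) → w (src r) ≡ w (snk c) ℚ.* fundamental c (src r)
    InVperp-plus {w} {r} {c} w∈V⊥ r∋c = InVperp-src w∈V⊥ r c sinks≡0
      where
      sinks≡0 : ∀ c' → c' ≢ c → A r (snk c') ℚ.* w (snk c') ≡ 0ℚ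
      sinks≡0 c' c'≢c = trans (cong (ℚ._* w (snk c')) (matrixA-snk≡0 amo r∌c')) (ℚP.*-zeroˡ (w (snk c')))
        where
        r∌c' : ¬ Plus D r (toℕ c')
        r∌c' r∋c' = c'≢c (FinP.toℕ-injective (amo r _ _ r∋c' r∋c))

    fundamental-support : ∀ {c j} → fundamental c j ≢ 0ℚ → j ≡ snk c ⊎ ∃ λ r → j ≡ src r × Plus D r (toℕ c)
    fundamental-support {c} {j} = label-elim (λ j → fundamental c j ≢ 0ℚ → j ≡ snk c ⊎ _) atSrc atSnk j
      where
      atSrc : ∀ r → fundamental c (src r) ≢ 0ℚ → src r ≡ snk c ⊎ ∃ λ r' → src r ≡ src r' × Plus D r' (toℕ c)
      atSrc r fv≢0 with Plus? D r (toℕ c)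
      ... | yes r∋c = inj₂ (r , refl , r∋c)
      ... | no  r∌c = contradiction (fundamental-src≡0 amo r∌c) fv≢0

      atSnk : ∀ c' → fundamental c (snk c') ≢ 0ℚ → snk c' ≡ snk c ⊎ ∃ λ r → snk c' ≡ src r × Plus D r (toℕ c)
      atSnk c' fv≢0 with c FinP.≟ c'
      ... | yes refl = inj₁ refl
      ... | no  c≢c' = contradiction (fundamental-snk-other c≢c') fv≢0

    fundamental-support-≤ : ∀ {c j} → fundamental c j ≢ 0ℚ → toℕ j ≤ toℕ (snk c)
    fundamental-support-≤ fv≢0 with fundamental-support fv≢0
    ... | inj₁ refl             = ℕP.≤-refl
    ... | inj₂ (r , refl , r∋c) = ℕP.<⇒≤ (src<snk (plus⇒<shape D r∋c))

    InVperp-on-fundamental-support : ∀ {w c j} → InVperp D w → fundamental c j ≢ 0ℚ →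
                                     w j ≡ w (snk c) ℚ.* fundamental c j
    InVperp-on-fundamental-support {w} {c} w∈V⊥ fv≢0 with fundamental-support fv≢0
    ... | inj₁ refl             = scale-fundamental-snk-self (w (snk c)) c
    ... | inj₂ (r , refl , r∋c) = InVperp-plus w∈V⊥ r∋c

    InVperp-snk≢0 : ∀ {w j} → InVperp D w → w j ≢ 0ℚ → ∃ λ c → w (snk c) ≢ 0ℚ
    InVperp-snk≢0 {w} w∈V⊥ = label-elim (λ j → w j ≢ 0ℚ → ∃ λ c → w (snk c) ≢ 0ℚ) atSrc (λ c wc≢0 → c , wc≢0) _
      where
      atSrc : ∀ r → w (src r) ≢ 0ℚ → ∃ λ c → w (snk c) ≢ 0ℚ
      atSrc r wr≢0 with FinP.any? (λ c → Plus? D r (toℕ c))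
      ... | yes (c , r∋c) = c , λ wc≡0 → wr≢0 (trans (InVperp-plus w∈V⊥ r∋c)
        (trans (cong (ℚ._* fundamental c (src r)) wc≡0) (ℚP.*-zeroˡ (fundamental c (src r)))))
      ... | no  none = contradiction (InVperp-emptyRow w∈V⊥ r (λ c r∋c → none (c , r∋c))) wr≢0

    circuit-support : ∀ {σ} → Circuit D σ → ∃ λ c → ∀ j → σ j ≡ 0ˢ ⇔ fundamental c j ≡ 0ℚ
    circuit-support {σ} ((v , v∈V⊥ , sv) , (i , σi≢0) , minimal)
      with InVperp-snk≢0 v∈V⊥ (sign≢0ˢ⇒≢0 (σi≢0 ∘ trans (sym (sv i))))
    ... | c , λ≢0 = c , λ j → mk⇔ (vanishes j) (vanishes⁻¹ j)
      where
      u : Fin n → ℚ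
      u j = v (snk c) ℚ.* fundamental c j

      u≤σ : (sign ∘ u) ≤ˢ σ
      u≤σ j uj≢0 = trans (cong sign (sym (InVperp-on-fundamental-support v∈V⊥ fvj≢0))) (sv j)
        where
        fvj≢0 : fundamental c j ≢ 0ℚ
        fvj≢0 fvj≡0 = uj≢0 (cong sign (trans (cong (v (snk c) ℚ.*_) fvj≡0) (ℚP.*-zeroʳ (v (snk c)))))

      σ≡ : ∀ j → σ j ≡ sign (v (snk c)) ·ˢ sign (fundamental c j)
      σ≡ j = trans (sym (minimal (sign ∘ u) (u , InVperp-scale (v (snk c)) (fundamental-InVperp c) , λ _ → refl)
                                 (snk c , sign≢0ˢ (*-≢0 λ≢0 (fundamental-snk≢0 c))) u≤σ j))
                   (sign-* (v (snk c)) (fundamental c j))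

      vanishes : ∀ j → σ j ≡ 0ˢ → fundamental c j ≡ 0ℚ
      vanishes j σj≡0 with ·ˢ≡0ˢ _ _ (trans (sym (σ≡ j)) σj≡0)
      ... | inj₁ sλ≡0  = contradiction sλ≡0 (sign≢0ˢ λ≢0)
      ... | inj₂ sfv≡0 = sign≡0ˢ⇒≡0 sfv≡0

      vanishes⁻¹ : ∀ j → fundamental c j ≡ 0ℚ → σ j ≡ 0ˢ
      vanishes⁻¹ j fvj≡0 = trans (σ≡ j) (trans (cong (λ q → sign (v (snk c)) ·ˢ sign q) fvj≡0) (·ˢ-zeroʳ _))

    gap-right-of-plus : LCondition D → ∀ {r c₀} → Plus D r (toℕ c₀) → ∀ b → src r < b → b < snk c₀ →
      fundamental c₀ b ≡ 0ℚ → ¬ Loop D b → ¬ Coloop D b → ⊥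
    gap-right-of-plus lc {r} {c₀} r∋c₀ = label-elim _ sourceGap sinkGap
      where
      sourceGap : ∀ s → src r < src s → src s < snk c₀ →
        fundamental c₀ (src s) ≡ 0ℚ → ¬ Loop D (src s) → ¬ Coloop D (src s) → ⊥
      sourceGap s r<s s<c₀ fs≡0 _ ¬coloop =
        zero-below-plus⇒empty-row D lc r∋c₀ (src-cancel-< r<s) (src<snk⇒<shape s<c₀)
          (λ s∋c₀ → fundamental-src≢0 s∋c₀ fs≡0) (proj₂ (¬Coloop⇒plusInRow s ¬coloop))

      sinkGap : ∀ c' → src r < snk c' → snk c' < snk c₀ →
        fundamental c₀ (snk c') ≡ 0ℚ → ¬ Loop D (snk c') → ¬ Coloop D (snk c') → ⊥
      sinkGap c' r<c' c'<c₀ _ ¬loop _ =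
        zero-right-of-plus⇒empty-column D amo lc r∋c₀ (snk-cancel-< c'<c₀) (src<snk⇒<shape r<c')
          (proj₂ (¬Loop⇒plusInColumn c' ¬loop))

    fundamental-gap-free : LCondition D → ∀ c₀ {a b c} → a < b → b < c →
      fundamental c₀ a ≢ 0ℚ → fundamental c₀ c ≢ 0ℚ → fundamental c₀ b ≡ 0ℚ → ¬ Loop D b → ¬ Coloop D b → ⊥
    fundamental-gap-free lc c₀ {a} {b} {c} a<b b<c fa≢0 fc≢0 fb≡0 ¬loop ¬coloop
      with fundamental-support {c₀} {a} fa≢0 | ℕP.<-≤-trans b<c (fundamental-support-≤ {c₀} {c} fc≢0)
    ... | inj₁ refl             | b<c₀ = ℕP.<-asym a<b b<c₀
    ... | inj₂ (r , refl , r∋c₀) | b<c₀ = gap-right-of-plus lc r∋c₀ b a<b b<c₀ fb≡0 ¬loop ¬coloop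

  -- Circuits with a gap

  InLbar⇒¬CircuitWithGap : InLbar D → ¬ CircuitWithGap D
  InLbar⇒¬CircuitWithGap (amo , lc) (σ , a , b , c , circuit , a<b , b<c , σa≢0 , σc≢0 , σb≡0 , ¬loop , ¬coloop) =
    let c₀ , supp = circuit-support amo {σ} circuit in
    fundamental-gap-free amo lc c₀ {a} {b} {c} a<b b<c
      (λ fa≡0 → σa≢0 (Equivalence.from (supp a) fa≡0)) (λ fc≡0 → σc≢0 (Equivalence.from (supp c) fc≡0))
      (Equivalence.to (supp b) σb≡0) ¬loop ¬coloop

  asColumn : ∀ {r c} → c ℕ.< shape D r → Σ (Fin m) λ f → toℕ f ≡ c
  asColumn {r} {c} c<sh = fromℕ< c<m , FinP.toℕ-fromℕ< c<m
    where
    c<m : c ℕ.< m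
    c<m = ℕP.<-≤-trans c<sh (shape-bound D r)

  twoPluses⇒CircuitWithGap : ∀ {r c₁ c₂} → Plus D r c₁ → Plus D r c₂ → c₁ ℕ.< c₂ → CircuitWithGap D
  twoPluses⇒CircuitWithGap {r} r∋c₁ r∋c₂ c₁<c₂
    with asColumn (plus⇒<shape D r∋c₁) | asColumn (plus⇒<shape D r∋c₂)
  ... | f₁ , refl | f₂ , refl =
    fundamentalSign f₁ , src r , snk f₂ , snk f₁ , fundamental-circuit f₁ ,
    src<snk {r} {f₂} (plus⇒<shape D r∋c₂) , snk-antimono-< {f₁} {f₂} c₁<c₂ ,
    sign≢0ˢ (fundamental-src≢0 {r} {f₁} r∋c₁) , sign≢0ˢ (fundamental-snk≢0 f₁) ,
    cong sign (fundamental-snk-other {f₁} {f₂} (ℕP.<⇒≢ c₁<c₂ ∘ cong toℕ)) ,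
    matrixA≢0⇒¬Loop {r} {snk f₂} (matrixA-snk≢0 {r} {f₂} r∋c₂) ,
    fundamental≢0⇒¬Coloop {f₂} {snk f₂} (fundamental-snk≢0 f₂)

  ¬CircuitWithGap⇒AtMostOnePlusPerRow : ¬ CircuitWithGap D → AtMostOnePlusPerRow D
  ¬CircuitWithGap⇒AtMostOnePlusPerRow noGap r c₁ c₂ r∋c₁ r∋c₂ with ℕP.<-cmp c₁ c₂
  ... | tri< c₁<c₂ _ _ = contradiction (twoPluses⇒CircuitWithGap r∋c₁ r∋c₂ c₁<c₂) noGap
  ... | tri≈ _ c₁≡c₂ _ = c₁≡c₂
  ... | tri> _ _ c₂<c₁ = contradiction (twoPluses⇒CircuitWithGap r∋c₂ r∋c₁ c₂<c₁) noGap

  lViolation⇒CircuitWithGap : AtMostOnePlusPerRow D → ∀ {r r' c c'} →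
    c ℕ.< shape D r → fill D r c ≡ false → toℕ r' ℕ.< toℕ r → fill D r' c ≡ true → c ℕ.< c' → Plus D r c' →
    CircuitWithGap D
  lViolation⇒CircuitWithGap amo {r} {r'} c<sh rc≡0 r'<r r'c≡+ c<c' r∋c'
    with asColumn c<sh | asColumn (plus⇒<shape D r∋c')
  ... | f , refl | f' , refl =
    fundamentalSign f , src r' , src r , snk f , fundamental-circuit f ,
    src-mono-< {r'} {r} r'<r , src<snk {r} {f} c<sh ,
    sign≢0ˢ (fundamental-src≢0 {r'} {f} (plus-intro D c<sh' r'c≡+)) , sign≢0ˢ (fundamental-snk≢0 f) ,
    cong sign (fundamental-src≡0 amo {r} {f} (zero⇒¬plus D rc≡0)) ,
    matrixA≢0⇒¬Loop {r} {src r} (ℚP.1≢0 ∘ trans (sym (matrixA-src-self r))) ,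
    fundamental≢0⇒¬Coloop {f'} {src r} (fundamental-src≢0 {r} {f'} r∋c')
    where
    c<sh' : toℕ f ℕ.< shape D r'
    c<sh' = ℕP.<-≤-trans c<sh (shape-mono D r' r (ℕP.<⇒≤ r'<r))

  ¬CircuitWithGap⇒LCondition : ¬ CircuitWithGap D → LCondition D
  ¬CircuitWithGap⇒LCondition noGap r c c<sh rc≡0 (r' , c' , r'<r , r'c≡+ , c<c' , r∋c') =
    noGap (lViolation⇒CircuitWithGap (¬CircuitWithGap⇒AtMostOnePlusPerRow noGap) c<sh rc≡0 r'<r r'c≡+ c<c' r∋c')

lemma8p14 : (k n : ℕ) → k ≤ n → (D : LeDiagram k n) →
    InLbar D ⇔
    (¬ (Σ (SignVec n) λ σ → Σ (Fin n) λ a → Σ (Fin n) λ b → Σ (Fin n) λ c →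
          Circuit D σ × a < b × b < c ×
          σ a ≢ 0ˢ × σ c ≢ 0ˢ × σ b ≡ 0ˢ ×
          ¬ Loop D b × ¬ Coloop D b))
lemma8p14 k n k≤n D =
  mk⇔ InLbar⇒¬CircuitWithGap (λ noGap → ¬CircuitWithGap⇒AtMostOnePlusPerRow noGap , ¬CircuitWithGap⇒LCondition noGap)
  where open Network k≤n D
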